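{- Let $G$ be a finite simple connected graph, let $k\ge 0$ be an integer, and let $H$ be a convex subgraph of $G$. If $S\subseteq V(H)$ is a mutual $k$-visible set in $G$, then $S$ is a mutual $k$-visible set in $H$.
   Context: A subgraph $H$ of $G$ is convex if for every pair of vertices $u,v\in V(H)$, every shortest $(u,v)$-path in $G$ is entirely contained in $H$. For a graph $F$, $X\subseteq V(F)$ and an integer $k\ge 0$, two vertices $u,v\in V(F)$ are called $(X,k)$-visible in $F$ if there exists a shortest $(u,v)$-path in $F$ having at most $k$ internal vertices that lie in $X$. A set $X\subseteq V(F)$ is a mutual $k$-visible set in $F$ if every pair of distinct vertices of $X$ is $(X,k)$-visible in $F$. -}

module Defs where

open import Data.Nat using (ℕ; zero; suc; _≤_)
open import Data.Fin using (Fin)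
open import Data.Fin.Subset using (Subset; _∈_)
open import Data.Fin.Subset.Properties using (_∈?_)
open import Data.List using (List; []; _∷_; filter; length)
open import Data.Product using (Σ; _×_; ∃-syntax)
open import Data.Unit using (⊤)
open import Data.Empty using (⊥)
open import Relation.Binary.PropositionalEquality using (_≡_; _≢_)
open import Relation.Nullary using (¬_)

record SimpleGraph (n : ℕ) : Set₁ where
  field
    Adj     : Fin n → Fin n → Set
    sym     : ∀ {u v} → Adj u v → Adj v u
    irrefl  : ∀ {u} → ¬ Adj u u

data Walk {n : ℕ} (E : Fin n → Fin n → Set) : Fin n → Fin n → Set where
  []  : ∀ {u} → Walk E u u
  _∷_ : ∀ {u w v} → E u w → Walk E w v → Walk E u v

module _ {n : ℕ} {E : Fin n → Fin n → Set} where

  len : ∀ {u v} → Walk E u v → ℕ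
  len []      = zero
  len (_ ∷ p) = suc (len p)

  vertices : ∀ {u v} → Walk E u v → List (Fin n)
  vertices {u} []      = u ∷ []
  vertices {u} (_ ∷ p) = u ∷ vertices p

  initVerts : ∀ {u v} → Walk E u v → List (Fin n)
  initVerts {u} []      = []
  initVerts {u} (_ ∷ p) = u ∷ initVerts p

  internal : ∀ {u v} → Walk E u v → List (Fin n)
  internal []      = []
  internal (_ ∷ p) = initVerts p

  -- a shortest (u,v)-walk (necessarily a path)
  IsShortest : ∀ {u v} → Walk E u v → Set
  IsShortest {u} {v} p = ∀ (q : Walk E u v) → len p ≤ len q

Connected : ∀ {n} → SimpleGraph n → Set
Connected G = ∀ u v → Walk (SimpleGraph.Adj G) u v

record Subgraph {n : ℕ} (G : SimpleGraph n) : Set₁ where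
  field
    VH     : Fin n → Set
    EH     : Fin n → Fin n → Set
    EH-sym : ∀ {u v} → EH u v → EH v u
    EH⇒Adj : ∀ {u v} → EH u v → SimpleGraph.Adj G u v
    EH⇒VHˡ : ∀ {u v} → EH u v → VH u
    EH⇒VHʳ : ∀ {u v} → EH u v → VH v

AllV : ∀ {n} → (Fin n → Set) → List (Fin n) → Set
AllV P []       = ⊤
AllV P (x ∷ xs) = P x × AllV P xs

EdgesIn : ∀ {n} {E : Fin n → Fin n → Set} (F : Fin n → Fin n → Set)
          → ∀ {u v} → Walk E u v → Set
EdgesIn F []                = ⊤
EdgesIn F (_∷_ {u} {w} _ p) = F u w × EdgesIn F p

Convex : ∀ {n} (G : SimpleGraph n) → Subgraph G → Set
Convex G H = ∀ u v → VH u → VH v → (p : Walk (SimpleGraph.Adj G) u v) →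
             IsShortest p → AllV VH (vertices p) × EdgesIn EH p
  where open Subgraph H

internalIn : ∀ {n} {E : Fin n → Fin n → Set} → Subset n → ∀ {u v} → Walk E u v → ℕ
internalIn X p = length (filter (_∈? X) (internal p))

Visible : ∀ {n} (E : Fin n → Fin n → Set) (X : Subset n) (k : ℕ) (u v : Fin n) → Set
Visible E X k u v = ∃[ p ] (IsShortest {E = E} {u} {v} p × internalIn X p ≤ k)

MutualVisible : ∀ {n} (E : Fin n → Fin n → Set) (X : Subset n) (k : ℕ) → Set
MutualVisible E X k = ∀ u v → u ∈ X → v ∈ X → u ≢ v → Visible E X k u v

{-# OPTIONS --safe #-}
-- A shortest G-path between two vertices of the convex subgraph H runs inside H,
-- so it is also an H-path; it is shortest in H because every H-path is a G-path,
-- and it has the same internal vertices, hence the same count of them in S.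
module Submission where

open import Defs
open import Data.Nat using (ℕ; suc; _≤_)
open import Data.Nat.Properties using (module ≤-Reasoning)
open import Data.Fin using (Fin)
open import Data.Fin.Subset using (Subset; _∈_)
open import Data.Fin.Subset.Properties using (_∈?_)
open import Data.List using (_∷_; filter; length)
open import Data.Product using (_,_; proj₂)
open import Relation.Binary.PropositionalEquality using (_≡_; refl; cong; subst; sym)

module _ {n : ℕ} {E F : Fin n → Fin n → Set} where

  mapWalk : (∀ {a b} → E a b → F a b) → ∀ {u v} → Walk E u v → Walk F u v
  mapWalk f []      = []
  mapWalk f (e ∷ p) = f e ∷ mapWalk f p

  len-mapWalk : (f : ∀ {a b} → E a b → F a b) → ∀ {u v} (p : Walk E u v) →
                len (mapWalk f p) ≡ len p
  len-mapWalk f []      = refl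
  len-mapWalk f (e ∷ p) = cong suc (len-mapWalk f p)

module _ {n : ℕ} {E F : Fin n → Fin n → Set} where

  restrict : ∀ {u v} (p : Walk E u v) → EdgesIn F p → Walk F u v
  restrict []      _        = []
  restrict (_ ∷ p) (f , fs) = f ∷ restrict p fs

  len-restrict : ∀ {u v} (p : Walk E u v) (fs : EdgesIn F p) → len (restrict p fs) ≡ len p
  len-restrict []      _        = refl
  len-restrict (_ ∷ p) (f , fs) = cong suc (len-restrict p fs)

  initVerts-restrict : ∀ {u v} (p : Walk E u v) (fs : EdgesIn F p) →
                       initVerts (restrict p fs) ≡ initVerts p
  initVerts-restrict []          _        = refl
  initVerts-restrict {u} (_ ∷ p) (f , fs) = cong (u ∷_) (initVerts-restrict p fs)

  internal-restrict : ∀ {u v} (p : Walk E u v) (fs : EdgesIn F p) →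
                      internal (restrict p fs) ≡ internal p
  internal-restrict []      _        = refl
  internal-restrict (_ ∷ p) (f , fs) = initVerts-restrict p fs

  internalIn-restrict : (X : Subset n) → ∀ {u v} (p : Walk E u v) (fs : EdgesIn F p) →
                        internalIn X (restrict p fs) ≡ internalIn X p
  internalIn-restrict X p fs = cong (λ vs → length (filter (_∈? X) vs)) (internal-restrict p fs)

  restrict-isShortest : (∀ {a b} → F a b → E a b) →
                        ∀ {u v} (p : Walk E u v) (fs : EdgesIn F p) →
                        IsShortest p → IsShortest (restrict p fs)
  restrict-isShortest F⇒E p fs p-shortest q = begin
    len (restrict p fs)   ≡⟨ len-restrict p fs ⟩
    len p                 ≤⟨ p-shortest (mapWalk F⇒E q) ⟩
    len (mapWalk F⇒E q)   ≡⟨ len-mapWalk F⇒E q ⟩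
    len q                 ∎
    where open ≤-Reasoning

  visible-restrict : (∀ {a b} → F a b → E a b) → (X : Subset n) (k : ℕ) →
                     ∀ {u v} (p : Walk E u v) → EdgesIn F p →
                     IsShortest p → internalIn X p ≤ k → Visible F X k u v
  visible-restrict F⇒E X k p fs p-shortest p-few =
    restrict p fs ,
    restrict-isShortest F⇒E p fs p-shortest ,
    subst (_≤ k) (sym (internalIn-restrict X p fs)) p-few

lemma3p3 : ∀ {n} (G : SimpleGraph n) → Connected G → (k : ℕ) →
    (H : Subgraph G) → Convex G H → (S : Subset n) →
    (∀ v → v ∈ S → Subgraph.VH H v) →
    MutualVisible (SimpleGraph.Adj G) S k →
    MutualVisible (Subgraph.EH H) S k
lemma3p3 G _ k H convex S S⊆VH visibleG u v u∈S v∈S u≢v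
  with visibleG u v u∈S v∈S u≢v
... | p , p-shortest , p-few =
  visible-restrict EH⇒Adj S k p p-in-H p-shortest p-few
  where
  open Subgraph H
  p-in-H : EdgesIn EH p
  p-in-H = proj₂ (convex u v (S⊆VH u u∈S) (S⊆VH v v∈S) p p-shortest)
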